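{- Let $q$ be a power of $2$ and let $\Sigma$ be the point set defined below. Then every triangle of $\mathrm{DUP}(q^2)$ has either $0$ or $2$ vertices in $\Sigma$.
   Context: In $\mathrm{PG}(2,q^2)$ (homogeneous coordinates over $\mathbb{F}_{q^2}$) consider the unitary polarity $(x,y,z)^\perp=[y^q,x^q,z^q]$, where $[a,b,c]$ is the line $aX+bY+cZ=0$; $\mathrm{DUP}(q^2)$ is the graph on the points with $P$ adjacent to $Q$ iff $P\in Q^\perp$, and a triangle is a set of three distinct pairwise adjacent points. Let $U_2=(0,1,0)$ and for $\lambda\in\mathbb{F}_q$ let $\mathcal{U}_\lambda$ be the Hermitian curve $\lambda X^{q+1}+X^qY+XY^q+Z^{q+1}=0$. Let $H$ be an additive subgroup of $\mathbb{F}_q$ of order $q/2$ with $1\notin H$, let $\Lambda=\{(h+1)^{ -1}: h\in H\}$, and let $\Sigma=\bigcup_{\lambda\in\Lambda}\mathcal{U}_\lambda\setminus\{U_2\}$. -}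

module Defs where

open import Level using (Level; suc; _⊔_)
open import Data.Nat as ℕ using (ℕ; zero; _^_)
import Data.Nat
open import Data.Fin using (Fin)
open import Data.Product using (Σ; ∃; _×_; _,_; proj₁)
open import Data.Sum using (_⊎_)
open import Data.List using (List; length)
open import Data.List.Membership.Propositional using (_∈_; _∉_)
open import Data.List.Relation.Unary.Unique.Propositional using (Unique)
open import Relation.Nullary using (¬_)
open import Relation.Binary.PropositionalEquality using (_≡_; _≢_)
open import Function.Bundles using (_↔_)

record Field (ℓ : Level) : Set (suc ℓ) where
  infixl 6 _+_
  infixl 7 _*_
  field
    Carrier : Set ℓ
    _+_ _*_ : Carrier → Carrier → Carrier
    -_      : Carrier → Carrier
    0# 1#   : Carrier
    +-assoc : ∀ x y z → (x + y) + z ≡ x + (y + z)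
    +-comm  : ∀ x y → x + y ≡ y + x
    +-identityˡ : ∀ x → 0# + x ≡ x
    -‿inverseˡ  : ∀ x → (- x) + x ≡ 0#
    *-assoc : ∀ x y z → (x * y) * z ≡ x * (y * z)
    *-comm  : ∀ x y → x * y ≡ y * x
    *-identityˡ : ∀ x → 1# * x ≡ x
    distribˡ : ∀ x y z → x * (y + z) ≡ (x * y) + (x * z)
    0≢1     : 0# ≢ 1#
    inverse : ∀ x → x ≢ 0# → ∃ λ y → x * y ≡ 1#

module FieldTheory {ℓ : Level} (F : Field ℓ) where
  open Field F

  _^'_ : Carrier → ℕ → Carrier
  x ^' zero = 1#
  x ^' ℕ.suc n = x * (x ^' n)

  HasOrder : ℕ → Set ℓ
  HasOrder n = Fin n ↔ Carrier

  -- homogeneous coordinates; a point of PG(2,F) is represented by a nonzero triple,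
  -- two representatives giving the same point iff they are proportional
  record Triple : Set ℓ where
    constructor ⟨_,_,_⟩
    field x y z : Carrier
  open Triple public

  NonZero : Triple → Set ℓ
  NonZero P = ¬ (x P ≡ 0# × y P ≡ 0# × z P ≡ 0#)

  record Point : Set ℓ where
    constructor pt
    field
      coords  : Triple
      nonzero : NonZero coords
  open Point public

  _·ₜ_ : Carrier → Triple → Triple
  c ·ₜ P = ⟨ c * x P , c * y P , c * z P ⟩

  _≈ₚ_ : Point → Point → Set ℓ
  P ≈ₚ Q = ∃ λ c → c ≢ 0# × coords Q ≡ c ·ₜ coords P

  module Unitary (q : ℕ) where
    _∈⊥_ : Point → Point → Set ℓ
    P ∈⊥ Q = ((y (coords Q) ^' q) * x (coords P)
              + (x (coords Q) ^' q) * y (coords P)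
              + (z (coords Q) ^' q) * z (coords P)) ≡ 0#

    Adj : Point → Point → Set ℓ
    Adj P Q = P ∈⊥ Q

    IsTriangle : Point → Point → Point → Set ℓ
    IsTriangle P Q R =
      ¬ (P ≈ₚ Q) × ¬ (P ≈ₚ R) × ¬ (Q ≈ₚ R) ×
      Adj P Q × Adj P R × Adj Q R

    InFq : Carrier → Set ℓ
    InFq a = a ^' q ≡ a

    OnU : Carrier → Point → Set ℓ
    OnU λ' P = (λ' * (X ^' Data.Nat._+_ q 1) + (X ^' q) * Y + X * (Y ^' q)
                + (Z ^' Data.Nat._+_ q 1)) ≡ 0#
      where X = x (coords P); Y = y (coords P); Z = z (coords P)

    U₂ : Point
    U₂ = pt ⟨ 0# , 1# , 0# ⟩ (λ { (_ , e , _) → 0≢1 (Relation.Binary.PropositionalEquality.sym e) })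

    record GoodSubgroup (H : List Carrier) : Set ℓ where
      field
        unique   : Unique H
        inFq     : ∀ {h} → h ∈ H → InFq h
        has0     : 0# ∈ H
        closed+  : ∀ {a b} → a ∈ H → b ∈ H → (a + b) ∈ H
        closed-  : ∀ {a} → a ∈ H → (- a) ∈ H
        order    : Data.Nat._*_ 2 (length H) ≡ q
        no1      : 1# ∉ H

    -- Λ = { (h+1)^{-1} : h ∈ H }
    InΛ : List Carrier → Carrier → Set ℓ
    InΛ H λ' = ∃ λ h → h ∈ H × λ' * (h + 1#) ≡ 1#

    InΣ : List Carrier → Point → Set ℓ
    InΣ H P = (∃ λ λ' → InΛ H λ' × OnU λ' P) × ¬ (P ≈ₚ U₂)

    ZeroOrTwo : (Point → Set ℓ) → Point → Point → Point → Set ℓ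
    ZeroOrTwo S P Q R =
      (¬ S P × ¬ S Q × ¬ S R)
      ⊎ (S P × S Q × ¬ S R)
      ⊎ (S P × ¬ S Q × S R)
      ⊎ (¬ S P × S Q × S R)

-- Adjacency is the vanishing of the Hermitian form B(P,Q) = ȳ_Q x_P + x̄_Q y_P + z̄_Q z_P, where
-- ā = a^q. The field has q² elements, so a^(q²) = a; its order is even, so the characteristic is 2
-- and a ↦ ā is an involutive automorphism with fixed field 𝔽_q. No vertex of a triangle is isotropic,
-- so every vertex P has a ratio a_P = x̄_P x_P / B(P,P) in 𝔽_q, and P ∈ Σ iff a_P + 1 ∈ H. The polar
-- of a vertex is the opposite side, which gives a_P = y(Q × R) x_P / det(P,Q,R); summed over the three
-- vertices this is a determinant with a repeated column, so the three values a + 1 add up to 1 ∉ H.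
-- As H has index 2 in 𝔽_q (a polynomial of degree q has at most q roots), an odd number of them in H
-- would put their sum in H.

module Submission where

open import Defs
open import Level using (Level; 0ℓ)
open import Data.Nat as ℕ using (ℕ; zero; suc)
import Data.Nat.Properties as ℕP
open import Data.Fin as Fin using (Fin)
open import Data.Fin.Properties using (punchInᵢ≢i)
open import Data.Vec.Functional using (removeAt)
open import Data.Bool using (Bool; true; false; _xor_; _∧_)
open import Data.Maybe using (Maybe; just; nothing)
open import Data.Empty using (⊥-elim)
open import Data.Product using (∃; _×_; _,_; proj₁; proj₂)
open import Data.Sum using (inj₁; inj₂)
open import Data.List using (List; []; _∷_; length; _++_; map)
open import Data.List.Properties using (length-++; length-map)
open import Data.List.Membership.Propositional using (_∈_; _∉_)
open import Data.List.Membership.Propositional.Properties using (∈-++⁻; ∈-map⁻)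
open import Data.List.Relation.Unary.All as All using (All; _∷_)
open import Data.List.Relation.Unary.AllPairs using (_∷_)
open import Data.List.Relation.Unary.Unique.Propositional using (Unique)
open import Data.List.Relation.Unary.Unique.Propositional.Properties using (++⁺; map⁺)
open import Function using (_∘_; _↔_; Inverse; mk↔ₛ′; _⇔_; mk⇔; Equivalence)
open import Function.Construct.Composition using (_↔-∘_)
open import Function.Properties.Inverse using (↔-sym; ↔⇒↣)
open import Relation.Binary.PropositionalEquality
open import Relation.Binary.Definitions using (DecidableEquality)
open import Relation.Nullary using (yes; no; ¬_)
open import Relation.Nullary.Decidable using (via-injection)
open import Algebra.Bundles using (CommutativeRing; RawRing)
open import Algebra.Structures using (IsCommutativeRing)
open import Algebra.Solver.Ring.AlmostCommutativeRing using (_-Raw-AlmostCommutative⟶_; fromCommutativeRing)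

cong₃ : ∀ {a b c d} {A : Set a} {B : Set b} {C : Set c} {D : Set d} (f : A → B → C → D)
        {u u′ v v′ w w′} → u ≡ u′ → v ≡ v′ → w ≡ w′ → f u v w ≡ f u′ v′ w′
cong₃ f refl refl refl = refl

module FieldProperties {ℓ : Level} (F : Field ℓ) where
  open Field F public
  open FieldTheory F using (_^'_)
  open ≡-Reasoning

  open import Algebra.Consequences.Propositional {A = Carrier}
    using (comm∧idˡ⇒idʳ; comm∧invˡ⇒invʳ; comm∧distrˡ⇒distrʳ)

  +-identityʳ : ∀ x → x + 0# ≡ x
  +-identityʳ = comm∧idˡ⇒idʳ +-comm +-identityˡ

  -‿inverseʳ : ∀ x → x + (- x) ≡ 0#
  -‿inverseʳ = comm∧invˡ⇒invʳ +-comm -‿inverseˡ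

  *-identityʳ : ∀ x → x * 1# ≡ x
  *-identityʳ = comm∧idˡ⇒idʳ *-comm *-identityˡ

  distribʳ : ∀ x y z → (y + z) * x ≡ (y * x) + (z * x)
  distribʳ = comm∧distrˡ⇒distrʳ *-comm distribˡ

  isCommutativeRing : IsCommutativeRing _≡_ _+_ _*_ -_ 0# 1#
  isCommutativeRing = record
    { isRing = record
      { +-isAbelianGroup = record
        { isGroup = record
          { isMonoid = record
            { isSemigroup = record
              { isMagma = record { isEquivalence = isEquivalence ; ∙-cong = cong₂ _+_ }
              ; assoc = +-assoc }
            ; identity = +-identityˡ , +-identityʳ }
          ; inverse = -‿inverseˡ , -‿inverseʳ
          ; ⁻¹-cong = cong -_ }
        ; comm = +-comm }
      ; *-cong = cong₂ _*_
      ; *-assoc = *-assoc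
      ; *-identity = *-identityˡ , *-identityʳ
      ; distrib = distribˡ , distribʳ }
    ; *-comm = *-comm }

  commutativeRing : CommutativeRing ℓ ℓ
  commutativeRing = record { isCommutativeRing = isCommutativeRing }

  open IsCommutativeRing isCommutativeRing public using (zeroˡ; zeroʳ)
  open import Algebra.Properties.CommutativeSemiring.Exp
    (CommutativeRing.commutativeSemiring commutativeRing) public
    using (_^_; ^-homo-*; ^-assocʳ; ^-distrib-*)

  ^'≡^ : ∀ x n → x ^' n ≡ x ^ n
  ^'≡^ x zero    = refl
  ^'≡^ x (suc n) = cong (x *_) (^'≡^ x n)

  ^'-homo-* : ∀ x m n → x ^' (m ℕ.+ n) ≡ (x ^' m) * (x ^' n)
  ^'-homo-* x m n rewrite ^'≡^ x (m ℕ.+ n) | ^'≡^ x m | ^'≡^ x n = ^-homo-* x m n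

  ^'-assocʳ : ∀ x m n → (x ^' m) ^' n ≡ x ^' (m ℕ.* n)
  ^'-assocʳ x m n rewrite ^'≡^ (x ^' m) n | ^'≡^ x m | ^'≡^ x (m ℕ.* n) = ^-assocʳ x m n

  ^'-distrib-* : ∀ x y n → (x * y) ^' n ≡ (x ^' n) * (y ^' n)
  ^'-distrib-* x y n rewrite ^'≡^ (x * y) n | ^'≡^ x n | ^'≡^ y n = ^-distrib-* x y n

  1^' : ∀ n → 1# ^' n ≡ 1#
  1^' zero    = refl
  1^' (suc n) = trans (*-identityˡ _) (1^' n)

  *-cancelˡ : ∀ {x y z} → x ≢ 0# → x * y ≡ x * z → y ≡ z
  *-cancelˡ {x} {y} {z} x≢0 xy≡xz with inverse x x≢0
  ... | x⁻¹ , xx⁻¹≡1 = begin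
    y               ≡⟨ *-identityˡ y ⟨
    1# * y          ≡⟨ cong (_* y) x⁻¹x≡1 ⟨
    (x⁻¹ * x) * y   ≡⟨ *-assoc x⁻¹ x y ⟩
    x⁻¹ * (x * y)   ≡⟨ cong (x⁻¹ *_) xy≡xz ⟩
    x⁻¹ * (x * z)   ≡⟨ *-assoc x⁻¹ x z ⟨
    (x⁻¹ * x) * z   ≡⟨ cong (_* z) x⁻¹x≡1 ⟩
    1# * z          ≡⟨ *-identityˡ z ⟩
    z               ∎
    where x⁻¹x≡1 = trans (*-comm x⁻¹ x) xx⁻¹≡1

  x*y≡0⇒y≡0 : ∀ {x y} → x ≢ 0# → x * y ≡ 0# → y ≡ 0#
  x*y≡0⇒y≡0 {x} x≢0 xy≡0 = *-cancelˡ x≢0 (trans xy≡0 (sym (zeroʳ x)))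

module FiniteField {ℓ : Level} (F : Field ℓ) {n : ℕ} (enumeration : Fin n ↔ Field.Carrier F) where
  open FieldProperties F
  open FieldTheory F using (_^'_)
  open Inverse enumeration using (to; from; strictlyInverseˡ; strictlyInverseʳ)
  open ≡-Reasoning

  infix 4 _≟_
  _≟_ : DecidableEquality Carrier
  _≟_ = via-injection (↔⇒↣ (↔-sym enumeration)) Fin._≟_

  open import Algebra.Properties.CommutativeMonoid.Sum
    (CommutativeRing.*-commutativeMonoid commutativeRing)
    using (sum-permute; ∑-distrib-+; sum-cong-≗; sum-remove; sum-replicate; sum-replicate-zero)
    renaming (sum to product)

  product-nonzero : ∀ {m} (f : Fin m → Carrier) → (∀ i → f i ≢ 0#) → product f ≢ 0#
  product-nonzero {zero}  f f≢0 1≡0 = 0≢1 (sym 1≡0)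
  product-nonzero {suc m} f f≢0 =
    product-nonzero (f ∘ Fin.suc) (f≢0 ∘ Fin.suc) ∘ x*y≡0⇒y≡0 (f≢0 Fin.zero)

  product-single : ∀ {m} (f : Fin m → Carrier) i → (∀ j → j ≢ i → f j ≡ 1#) → product f ≡ f i
  product-single {suc m} f i f≡1 = begin
    product f                    ≡⟨ sum-remove f ⟩
    f i * product (removeAt f i) ≡⟨ cong (f i *_) (sum-cong-≗ {m} (f≡1 _ ∘ punchInᵢ≢i i)) ⟩
    f i * product {m} (λ _ → 1#) ≡⟨ cong (f i *_) (sum-replicate-zero m) ⟩
    f i * 1#                     ≡⟨ *-identityʳ (f i) ⟩
    f i                          ∎

  private
    zeroToOne : Carrier → Carrier
    zeroToOne y with y ≟ 0#
    ... | yes _ = 1#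
    ... | no  _ = y

    zeroToOne≢0 : ∀ y → zeroToOne y ≢ 0#
    zeroToOne≢0 y with y ≟ 0#
    ... | yes _   = λ 1≡0 → 0≢1 (sym 1≡0)
    ... | no  y≢0 = y≢0

    module _ {c : Carrier} (c≢0 : c ≢ 0#) where
      c⁻¹ : Carrier
      c⁻¹ = proj₁ (inverse c c≢0)

      cc⁻¹≡1 : c * c⁻¹ ≡ 1#
      cc⁻¹≡1 = proj₂ (inverse c c≢0)

      scaling : Carrier ↔ Carrier
      scaling = mk↔ₛ′ (c *_) (c⁻¹ *_) (cancel c c⁻¹ cc⁻¹≡1)
                      (cancel c⁻¹ c (trans (*-comm c⁻¹ c) cc⁻¹≡1))
        where
        cancel : ∀ a b → a * b ≡ 1# → ∀ y → a * (b * y) ≡ y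
        cancel a b ab≡1 y = trans (sym (*-assoc a b y)) (trans (cong (_* y) ab≡1) (*-identityˡ y))

      cAtZero : Carrier → Carrier
      cAtZero y with y ≟ 0#
      ... | yes _ = c
      ... | no  _ = 1#

      zeroToOne-scale : ∀ y → c * zeroToOne y ≡ zeroToOne (c * y) * cAtZero y
      zeroToOne-scale y with y ≟ 0# | c * y ≟ 0#
      ... | yes _   | yes _    = trans (*-identityʳ c) (sym (*-identityˡ c))
      ... | yes y≡0 | no cy≢0  = ⊥-elim (cy≢0 (trans (cong (c *_) y≡0) (zeroʳ c)))
      ... | no  y≢0 | yes cy≡0 = ⊥-elim (y≢0 (x*y≡0⇒y≡0 c≢0 cy≡0))
      ... | no  _   | no  _    = sym (*-identityʳ (c * y))

      product-cAtZero : product (cAtZero ∘ to) ≡ c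
      product-cAtZero = trans (product-single _ (from 0#) cAtZero≡1) cAtZero-0
        where
        cAtZero≡1 : ∀ i → i ≢ from 0# → cAtZero (to i) ≡ 1#
        cAtZero≡1 i i≢ with to i ≟ 0#
        ... | yes toi≡0 = ⊥-elim (i≢ (trans (sym (strictlyInverseʳ i)) (cong from toi≡0)))
        ... | no  _     = refl
        cAtZero-0 : cAtZero (to (from 0#)) ≡ c
        cAtZero-0 with to (from 0#) ≟ 0#
        ... | yes _ = refl
        ... | no to0≢0 = ⊥-elim (to0≢0 (strictlyInverseˡ 0#))

      -- Multiplication by c permutes the field; compare the products of all elements, 0 replaced by 1.
      fermat-nonzero : c ^' n ≡ c
      fermat-nonzero = *-cancelˡ (product-nonzero _ (zeroToOne≢0 ∘ to)) (begin
        Π * c ^' n                                          ≡⟨ *-comm Π _ ⟩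
        c ^' n * Π                                          ≡⟨ cong (_* Π) (trans (^'≡^ c n) (sym (sum-replicate n))) ⟩
        product {n} (λ _ → c) * Π                           ≡⟨ ∑-distrib-+ (λ _ → c) (zeroToOne ∘ to) ⟨
        product (λ i → c * zeroToOne (to i))                ≡⟨ sum-cong-≗ (zeroToOne-scale ∘ to) ⟩
        product (λ i → zeroToOne (c * to i) * cAtZero (to i)) ≡⟨ ∑-distrib-+ _ (cAtZero ∘ to) ⟩
        product (λ i → zeroToOne (c * to i)) * product (cAtZero ∘ to) ≡⟨ cong₂ _*_ Π-invariant product-cAtZero ⟩
        Π * c                                               ∎)
        where
        Π : Carrier
        Π = product (zeroToOne ∘ to)
        Π-invariant : product (λ i → zeroToOne (c * to i)) ≡ Π
        Π-invariant = sym (trans (sum-permute (zeroToOne ∘ to) (↔-sym enumeration ↔-∘ (scaling ↔-∘ enumeration)))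
                                 (sum-cong-≗ (λ i → cong zeroToOne (strictlyInverseˡ (c * to i)))))

  fermat : ∀ c → c ^' n ≡ c
  fermat c with c ≟ 0#
  ... | no  c≢0 = fermat-nonzero c≢0
  ... | yes refl = zero-power (from 0#)
    where
    zero-power : ∀ {m} → Fin m → 0# ^' m ≡ 0#
    zero-power {suc m} _ = zeroˡ (0# ^' m)

  characteristic-two : ∀ m → n ≡ 2 ℕ.* m → 1# + 1# ≡ 0#
  characteristic-two m n≡2m = begin
    1# + 1#                ≡⟨ cong (1# +_) -1≡1 ⟨
    1# + - 1#              ≡⟨ -‿inverseʳ 1# ⟩
    0#                     ∎
    where
    open import Algebra.Properties.Ring (CommutativeRing.ring commutativeRing) using (-1*x≈-x; -‿involutive)
    [-1]²≡1 : (- 1#) ^' 2 ≡ 1#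
    [-1]²≡1 = trans (cong (- 1# *_) (*-identityʳ (- 1#))) (trans (-1*x≈-x (- 1#)) (-‿involutive 1#))
    -1≡1 : - 1# ≡ 1#
    -1≡1 = begin
      - 1#                  ≡⟨ fermat (- 1#) ⟨
      (- 1#) ^' n           ≡⟨ cong ((- 1#) ^'_) n≡2m ⟩
      (- 1#) ^' (2 ℕ.* m)   ≡⟨ ^'-assocʳ (- 1#) 2 m ⟨
      ((- 1#) ^' 2) ^' m    ≡⟨ cong (_^' m) [-1]²≡1 ⟩
      1# ^' m               ≡⟨ 1^' m ⟩
      1#                    ∎

module Characteristic2 {ℓ : Level} (F : Field ℓ) (1+1≡0 : Field._+_ F (Field.1# F) (Field.1# F) ≡ Field.0# F) where
  open FieldProperties F
  open FieldTheory F using (_^'_)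
  open ≡-Reasoning

  x+x≡0 : ∀ x → x + x ≡ 0#
  x+x≡0 x = begin
    x + x             ≡⟨ cong₂ _+_ (*-identityˡ x) (*-identityˡ x) ⟨
    1# * x + 1# * x   ≡⟨ distribʳ x 1# 1# ⟨
    (1# + 1#) * x     ≡⟨ cong (_* x) 1+1≡0 ⟩
    0# * x            ≡⟨ zeroˡ x ⟩
    0#                ∎

  -x≡x : ∀ x → - x ≡ x
  -x≡x x = begin
    - x               ≡⟨ +-identityʳ (- x) ⟨
    - x + 0#          ≡⟨ cong (- x +_) (x+x≡0 x) ⟨
    - x + (x + x)     ≡⟨ +-assoc (- x) x x ⟨
    (- x + x) + x     ≡⟨ cong (_+ x) (-‿inverseˡ x) ⟩
    0# + x            ≡⟨ +-identityˡ x ⟩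
    x                 ∎

  -- The ring solver with coefficients in 𝔽₂ = (Bool, xor, ∧); in characteristic 2 the map 𝔽₂ → F
  -- is a ring morphism, so this solver also proves identities that need x + x = 0.
  private
    ⟦_⟧𝔽₂ : Bool → Carrier
    ⟦ true  ⟧𝔽₂ = 1#
    ⟦ false ⟧𝔽₂ = 0#

    𝔽₂ : RawRing 0ℓ 0ℓ
    𝔽₂ = record { _≈_ = _≡_ ; _+_ = _xor_ ; _*_ = _∧_ ; -_ = λ b → b ; 0# = false ; 1# = true }

    𝔽₂⟶F : 𝔽₂ -Raw-AlmostCommutative⟶ fromCommutativeRing commutativeRing
    𝔽₂⟶F = record
      { ⟦_⟧    = ⟦_⟧𝔽₂
      ; +-homo = λ { true  true  → sym 1+1≡0
                   ; true  false → sym (+-identityʳ 1#)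
                   ; false b     → sym (+-identityˡ ⟦ b ⟧𝔽₂) }
      ; *-homo = λ { true b → sym (*-identityˡ ⟦ b ⟧𝔽₂) ; false b → sym (zeroˡ ⟦ b ⟧𝔽₂) }
      ; -‿homo = λ b → sym (-x≡x ⟦ b ⟧𝔽₂)
      ; 0-homo = refl
      ; 1-homo = refl }

    𝔽₂-equal? : ∀ a b → Maybe (⟦ a ⟧𝔽₂ ≡ ⟦ b ⟧𝔽₂)
    𝔽₂-equal? true  true  = just refl
    𝔽₂-equal? false false = just refl
    𝔽₂-equal? _     _     = nothing

  open import Algebra.Solver.Ring 𝔽₂ (fromCommutativeRing commutativeRing) 𝔽₂⟶F 𝔽₂-equal? public
    using (solve; _:=_; _:+_; _:*_; con)

  x+y≡0⇒x≡y : ∀ {x y} → x + y ≡ 0# → x ≡ y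
  x+y≡0⇒x≡y {x} {y} x+y≡0 = begin
    x              ≡⟨ solve 2 (λ x y → x := (x :+ y) :+ y) refl x y ⟩
    (x + y) + y    ≡⟨ cong (_+ y) x+y≡0 ⟩
    0# + y         ≡⟨ +-identityˡ y ⟩
    y              ∎

  frobenius : ∀ j a b → (a + b) ^' (2 ℕ.^ j) ≡ a ^' (2 ℕ.^ j) + b ^' (2 ℕ.^ j)
  frobenius zero    a b = solve 2 (λ a b → (a :+ b) :* con true := a :* con true :+ b :* con true) refl a b
  frobenius (suc j) a b = begin
    (a + b) ^' (2 ℕ.* 2^j)              ≡⟨ ^'-assocʳ (a + b) 2 2^j ⟨
    ((a + b) ^' 2) ^' 2^j                ≡⟨ cong (_^' 2^j) (square-+ a b) ⟩
    (a ^' 2 + b ^' 2) ^' 2^j             ≡⟨ frobenius j (a ^' 2) (b ^' 2) ⟩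
    (a ^' 2) ^' 2^j + (b ^' 2) ^' 2^j    ≡⟨ cong₂ _+_ (^'-assocʳ a 2 2^j) (^'-assocʳ b 2 2^j) ⟩
    a ^' (2 ℕ.* 2^j) + b ^' (2 ℕ.* 2^j)  ∎
    where
    2^j = 2 ℕ.^ j
    square-+ : ∀ u v → (u + v) ^' 2 ≡ u ^' 2 + v ^' 2
    square-+ = solve 2 (λ u v → (u :+ v) :* ((u :+ v) :* con true) := u :* (u :* con true) :+ v :* (v :* con true)) refl

  -- Monic d f: f is the function of a monic polynomial of degree d, given in Horner form.
  data Monic : ℕ → (Carrier → Carrier) → Set ℓ where
    one    : ∀ {f} → (∀ x → f x ≡ 1#) → Monic 0 f
    horner : ∀ {d f g} c → Monic d g → (∀ x → f x ≡ c + x * g x) → Monic (suc d) f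

  divide-by-linear : ∀ {d f} → Monic (suc d) f → ∀ r →
                     ∃ λ g → Monic d g × (∀ x → f x ≡ (x + r) * g x + f r)
  divide-by-linear {f = f} (horner {g = g} c (one g≡1) f≡) r = g , one g≡1 , λ x → begin
    f x                            ≡⟨ f≡ x ⟩
    c + x * g x                    ≡⟨ cong (λ t → c + x * t) (g≡1 x) ⟩
    c + x * 1#                     ≡⟨ solve 3 (λ x r c → c :+ x :* con true
                                                         := (x :+ r) :* con true :+ (c :+ r :* con true))
                                               refl x r c ⟩
    (x + r) * 1# + (c + r * 1#)    ≡⟨ cong₂ (λ u v → (x + r) * u + (c + r * v)) (g≡1 x) (g≡1 r) ⟨
    (x + r) * g x + (c + r * g r)  ≡⟨ cong ((x + r) * g x +_) (f≡ r) ⟨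
    (x + r) * g x + f r            ∎
  divide-by-linear {f = f} (horner {g = g} c g-monic@(horner _ _ _) f≡) r
    with divide-by-linear g-monic r
  ... | h , h-monic , g≡ = (λ x → g r + x * h x) , horner (g r) h-monic (λ _ → refl) , λ x → begin
    f x                                          ≡⟨ f≡ x ⟩
    c + x * g x                                  ≡⟨ cong (λ t → c + x * t) (g≡ x) ⟩
    c + x * ((x + r) * h x + g r)                ≡⟨ solve 5 (λ x r c G H → c :+ x :* ((x :+ r) :* H :+ G)
                                                                        := (x :+ r) :* (G :+ x :* H) :+ (c :+ r :* G))
                                                             refl x r c (g r) (h x) ⟩
    (x + r) * (g r + x * h x) + (c + r * g r)    ≡⟨ cong ((x + r) * (g r + x * h x) +_) (f≡ r) ⟨
    (x + r) * (g r + x * h x) + f r              ∎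

  roots-bound : ∀ {d f} → Monic d f → ∀ {rs} → Unique rs → All (λ r → f r ≡ 0#) rs → length rs ℕ.≤ d
  roots-bound _ {[]} _ _ = ℕ.z≤n
  roots-bound (one f≡1) {r ∷ _} _ (fr≡0 ∷ _) = ⊥-elim (0≢1 (trans (sym fr≡0) (f≡1 r)))
  roots-bound {f = f} f-monic@(horner _ _ _) {r ∷ _} (r≢rs ∷ rs-unique) (fr≡0 ∷ frs≡0)
    with divide-by-linear f-monic r
  ... | g , g-monic , f≡ = ℕ.s≤s (roots-bound g-monic rs-unique (All.zipWith root-of-quotient (r≢rs , frs≡0)))
    where
    root-of-quotient : ∀ {s} → r ≢ s × f s ≡ 0# → g s ≡ 0#
    root-of-quotient {s} (r≢s , fs≡0) = x*y≡0⇒y≡0 (r≢s ∘ sym ∘ x+y≡0⇒x≡y) (begin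
      (s + r) * g s        ≡⟨ +-identityʳ _ ⟨
      (s + r) * g s + 0#   ≡⟨ cong ((s + r) * g s +_) fr≡0 ⟨
      (s + r) * g s + f r  ≡⟨ f≡ s ⟨
      f s                  ≡⟨ fs≡0 ⟩
      0#                   ∎)

  monic-^' : ∀ d → Monic d (_^' d)
  monic-^' zero    = one (λ _ → refl)
  monic-^' (suc d) = horner 0# (monic-^' d) (λ x → sym (+-identityˡ (x ^' suc d)))

  monic-^'+id : ∀ d → Monic (suc (suc d)) (λ x → x ^' suc (suc d) + x)
  monic-^'+id d = horner 0# (horner 1# (monic-^' d) (λ x → +-comm (x ^' suc d) 1#)) λ x →
    solve 2 (λ x p → x :* (x :* p) :+ x := con false :+ x :* (x :* p :+ con true)) refl x (x ^' d)

module UnitaryPlane {ℓ : Level} (F : Field ℓ) (k : ℕ)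
  (_≟_ : DecidableEquality (Field.Carrier F))
  (1+1≡0 : Field._+_ F (Field.1# F) (Field.1# F) ≡ Field.0# F)
  (fermat : ∀ c → FieldTheory._^'_ F c (2 ℕ.^ k ℕ.* 2 ℕ.^ k) ≡ c) where
  open FieldProperties F
  open FieldTheory F
  open Characteristic2 F 1+1≡0
  open Equivalence using (to; from)
  open ≡-Reasoning

  q : ℕ
  q = 2 ℕ.^ k

  open Unitary q

  conj : Carrier → Carrier
  conj a = a ^' q

  conj-+ : ∀ a b → conj (a + b) ≡ conj a + conj b
  conj-+ = frobenius k

  conj-* : ∀ a b → conj (a * b) ≡ conj a * conj b
  conj-* a b = ^'-distrib-* a b q

  conj-involutive : ∀ a → conj (conj a) ≡ a
  conj-involutive a = trans (^'-assocʳ a q q) (fermat a)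

  conj-injective : ∀ {a b} → conj a ≡ conj b → a ≡ b
  conj-injective {a} {b} eq = begin
    a               ≡⟨ conj-involutive a ⟨
    conj (conj a)   ≡⟨ cong conj eq ⟩
    conj (conj b)   ≡⟨ conj-involutive b ⟩
    b               ∎

  conj-0 : conj 0# ≡ 0#
  conj-0 = begin
    conj 0#             ≡⟨ cong conj (+-identityˡ 0#) ⟨
    conj (0# + 0#)      ≡⟨ conj-+ 0# 0# ⟩
    conj 0# + conj 0#   ≡⟨ x+x≡0 (conj 0#) ⟩
    0#                  ∎

  conj-1 : conj 1# ≡ 1#
  conj-1 = 1^' q

  conj≡0 : ∀ {a} → conj a ≡ 0# → a ≡ 0#
  conj≡0 eq = conj-injective (trans eq (sym conj-0))

  dot : Triple → Triple → Carrier
  dot u v = x u * x v + y u * y v + z u * z v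

  polar : Triple → Triple
  polar v = ⟨ conj (y v) , conj (x v) , conj (z v) ⟩

  form : Point → Point → Carrier
  form P Q = dot (polar (coords Q)) (coords P)

  form-conj : ∀ P Q → form Q P ≡ conj (form P Q)
  form-conj P Q = sym (begin
    conj (conj y₂ * x₁ + conj x₂ * y₁ + conj z₂ * z₁)
      ≡⟨ trans (conj-+ _ _) (cong (_+ conj (conj z₂ * z₁)) (conj-+ _ _)) ⟩
    conj (conj y₂ * x₁) + conj (conj x₂ * y₁) + conj (conj z₂ * z₁)
      ≡⟨ cong₃ (λ a b c → a + b + c) (conj-conj* y₂ x₁) (conj-conj* x₂ y₁) (conj-conj* z₂ z₁) ⟩
    y₂ * conj x₁ + x₂ * conj y₁ + z₂ * conj z₁
      ≡⟨ solve 6 (λ x₂ y₂ z₂ a b c → y₂ :* a :+ x₂ :* b :+ z₂ :* c := b :* x₂ :+ a :* y₂ :+ c :* z₂)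
               refl x₂ y₂ z₂ (conj x₁) (conj y₁) (conj z₁) ⟩
    form Q P ∎)
    where
    x₁ = x (coords P) ; y₁ = y (coords P) ; z₁ = z (coords P)
    x₂ = x (coords Q) ; y₂ = y (coords Q) ; z₂ = z (coords Q)
    conj-conj* : ∀ a b → conj (conj a * b) ≡ a * conj b
    conj-conj* a b = trans (conj-* (conj a) b) (cong (_* conj b) (conj-involutive a))

  Adj-sym : ∀ {P Q} → Adj P Q → Adj Q P
  Adj-sym {P} {Q} PQ = trans (form-conj P Q) (trans (cong conj PQ) conj-0)

  IsZero : Triple → Set ℓ
  IsZero v = x v ≡ 0# × y v ≡ 0# × z v ≡ 0#

  ·ₜ-assoc : ∀ a b v → a ·ₜ (b ·ₜ v) ≡ (a * b) ·ₜ v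
  ·ₜ-assoc a b v = cong₃ ⟨_,_,_⟩ (sym (*-assoc a b (x v))) (sym (*-assoc a b (y v))) (sym (*-assoc a b (z v)))

  ·ₜ-identityˡ : ∀ v → 1# ·ₜ v ≡ v
  ·ₜ-identityˡ v = cong₃ ⟨_,_,_⟩ (*-identityˡ (x v)) (*-identityˡ (y v)) (*-identityˡ (z v))

  scalar≢0 : ∀ (Q : Point) {c v} → coords Q ≡ c ·ₜ v → c ≢ 0#
  scalar≢0 Q {c} {v} Q≡cv c≡0 =
    nonzero Q (trans (cong x Q≡cv) (0*_ (x v)) , trans (cong y Q≡cv) (0*_ (y v)) , trans (cong z Q≡cv) (0*_ (z v)))
    where
    0*_ : ∀ w → c * w ≡ 0#
    0* w = trans (cong (_* w) c≡0) (zeroˡ w)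

  ≈ₚ-intro : ∀ {P Q c} → coords Q ≡ c ·ₜ coords P → P ≈ₚ Q
  ≈ₚ-intro {Q = Q} Q≡cP = _ , scalar≢0 Q Q≡cP , Q≡cP

  ≈ₚ-sym : ∀ {P Q} → P ≈ₚ Q → Q ≈ₚ P
  ≈ₚ-sym {P} {Q} (c , c≢0 , Q≡cP) with inverse c c≢0
  ... | c⁻¹ , cc⁻¹≡1 = ≈ₚ-intro {Q} {P} (begin
    coords P              ≡⟨ ·ₜ-identityˡ (coords P) ⟨
    1# ·ₜ coords P        ≡⟨ cong (_·ₜ coords P) (trans (*-comm c⁻¹ c) cc⁻¹≡1) ⟨
    (c⁻¹ * c) ·ₜ coords P ≡⟨ ·ₜ-assoc c⁻¹ c (coords P) ⟨
    c⁻¹ ·ₜ (c ·ₜ coords P) ≡⟨ cong (c⁻¹ ·ₜ_) Q≡cP ⟨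
    c⁻¹ ·ₜ coords Q       ∎)

  ≈ₚ-trans : ∀ {P Q R} → P ≈ₚ Q → Q ≈ₚ R → P ≈ₚ R
  ≈ₚ-trans {P} {Q} {R} (c , _ , Q≡cP) (d , _ , R≡dQ) =
    ≈ₚ-intro {P} {R} (trans R≡dQ (trans (cong (d ·ₜ_) Q≡cP) (·ₜ-assoc d c (coords P))))

  cross : Triple → Triple → Triple
  cross u v = ⟨ y u * z v + z u * y v , z u * x v + x u * z v , x u * y v + y u * x v ⟩

  proportional : ∀ {a₁ b₁ a₂ b₂} (a₁≢0 : a₁ ≢ 0#) → a₁ * b₂ ≡ a₂ * b₁ →
                 b₂ ≡ (b₁ * proj₁ (inverse a₁ a₁≢0)) * a₂
  proportional {a₁} {b₁} {a₂} {b₂} a₁≢0 a₁b₂≡a₂b₁ = *-cancelˡ a₁≢0 (begin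
    a₁ * b₂                  ≡⟨ a₁b₂≡a₂b₁ ⟩
    a₂ * b₁                  ≡⟨ *-identityˡ (a₂ * b₁) ⟨
    1# * (a₂ * b₁)           ≡⟨ cong (_* (a₂ * b₁)) (proj₂ (inverse a₁ a₁≢0)) ⟨
    (a₁ * a⁻¹) * (a₂ * b₁)   ≡⟨ solve 4 (λ a₁ a⁻¹ a₂ b₁ → (a₁ :* a⁻¹) :* (a₂ :* b₁) := a₁ :* ((b₁ :* a⁻¹) :* a₂))
                                       refl a₁ a⁻¹ a₂ b₁ ⟩
    a₁ * ((b₁ * a⁻¹) * a₂)   ∎)
    where a⁻¹ = proj₁ (inverse a₁ a₁≢0)

  cross-zero⇒≈ₚ : ∀ P Q → IsZero (cross (coords P) (coords Q)) → P ≈ₚ Q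
  cross-zero⇒≈ₚ P Q (yz , zx , xy) with x (coords P) ≟ 0# | y (coords P) ≟ 0# | z (coords P) ≟ 0#
  ... | no x≢0 | _ | _ = ≈ₚ-intro {P} {Q} (cong₃ ⟨_,_,_⟩
    (proportional x≢0 refl) (proportional x≢0 (x+y≡0⇒x≡y xy)) (proportional x≢0 (sym (x+y≡0⇒x≡y zx))))
  ... | yes _ | no y≢0 | _ = ≈ₚ-intro {P} {Q} (cong₃ ⟨_,_,_⟩
    (proportional y≢0 (sym (x+y≡0⇒x≡y xy))) (proportional y≢0 refl) (proportional y≢0 (x+y≡0⇒x≡y yz)))
  ... | yes _ | yes _ | no z≢0 = ≈ₚ-intro {P} {Q} (cong₃ ⟨_,_,_⟩
    (proportional z≢0 (x+y≡0⇒x≡y zx)) (proportional z≢0 (sym (x+y≡0⇒x≡y yz))) (proportional z≢0 refl))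
  ... | yes x≡0 | yes y≡0 | yes z≡0 = ⊥-elim (nonzero P (x≡0 , y≡0 , z≡0))

  crossPoint : (P Q : Point) → ¬ P ≈ₚ Q → Point
  crossPoint P Q P≉Q = pt (cross (coords P) (coords Q)) (P≉Q ∘ cross-zero⇒≈ₚ P Q)

  polarPoint : Point → Point
  polarPoint P = pt (polar (coords P)) λ (y≡0 , x≡0 , z≡0) →
    nonzero P (conj≡0 x≡0 , conj≡0 y≡0 , conj≡0 z≡0)

  polarPoint-reflects-≈ₚ : ∀ {P Q} → polarPoint P ≈ₚ polarPoint Q → P ≈ₚ Q
  polarPoint-reflects-≈ₚ {P} {Q} (c , _ , Q≡cP) =
    ≈ₚ-intro {P} {Q} (cong₃ ⟨_,_,_⟩ (unconj (cong y Q≡cP)) (unconj (cong x Q≡cP)) (unconj (cong z Q≡cP)))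
    where
    unconj : ∀ {a b} → conj b ≡ c * conj a → b ≡ conj c * a
    unconj {a} {b} eq = begin
      b                     ≡⟨ conj-involutive b ⟨
      conj (conj b)         ≡⟨ cong conj eq ⟩
      conj (c * conj a)     ≡⟨ conj-* c (conj a) ⟩
      conj c * conj (conj a) ≡⟨ cong (conj c *_) (conj-involutive a) ⟩
      conj c * a            ∎

  -- (u × v) × w = (w · v) u + (w · u) v, the signs being irrelevant in characteristic 2.
  cross-cross-zero : ∀ u v w → dot w u ≡ 0# → dot w v ≡ 0# → IsZero (cross (cross u v) w)
  cross-cross-zero u v w w·u≡0 w·v≡0 =
    vanishes (solve 9 (λ u₁ u₂ u₃ v₁ v₂ v₃ w₁ w₂ w₃ →
      (u₃ :* v₁ :+ u₁ :* v₃) :* w₃ :+ (u₁ :* v₂ :+ u₂ :* v₁) :* w₂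
        := u₁ :* (w₁ :* v₁ :+ w₂ :* v₂ :+ w₃ :* v₃) :+ v₁ :* (w₁ :* u₁ :+ w₂ :* u₂ :+ w₃ :* u₃))
      refl (x u) (y u) (z u) (x v) (y v) (z v) (x w) (y w) (z w)) ,
    vanishes (solve 9 (λ u₁ u₂ u₃ v₁ v₂ v₃ w₁ w₂ w₃ →
      (u₁ :* v₂ :+ u₂ :* v₁) :* w₁ :+ (u₂ :* v₃ :+ u₃ :* v₂) :* w₃
        := u₂ :* (w₁ :* v₁ :+ w₂ :* v₂ :+ w₃ :* v₃) :+ v₂ :* (w₁ :* u₁ :+ w₂ :* u₂ :+ w₃ :* u₃))
      refl (x u) (y u) (z u) (x v) (y v) (z v) (x w) (y w) (z w)) ,
    vanishes (solve 9 (λ u₁ u₂ u₃ v₁ v₂ v₃ w₁ w₂ w₃ →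
      (u₂ :* v₃ :+ u₃ :* v₂) :* w₂ :+ (u₃ :* v₁ :+ u₁ :* v₃) :* w₁
        := u₃ :* (w₁ :* v₁ :+ w₂ :* v₂ :+ w₃ :* v₃) :+ v₃ :* (w₁ :* u₁ :+ w₂ :* u₂ :+ w₃ :* u₃))
      refl (x u) (y u) (z u) (x v) (y v) (z v) (x w) (y w) (z w))
    where
    vanishes : ∀ {c a b} → c ≡ a * dot w v + b * dot w u → c ≡ 0#
    vanishes {c} {a} {b} eq = begin
      c                           ≡⟨ eq ⟩
      a * dot w v + b * dot w u   ≡⟨ cong₂ (λ s t → a * s + b * t) w·v≡0 w·u≡0 ⟩
      a * 0# + b * 0#             ≡⟨ cong₂ _+_ (zeroʳ a) (zeroʳ b) ⟩
      0# + 0#                     ≡⟨ +-identityˡ 0# ⟩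
      0#                          ∎

  cross≈ₚpolar : ∀ {A C P} (A≉C : ¬ A ≈ₚ C) → A ∈⊥ P → C ∈⊥ P →
                 crossPoint A C A≉C ≈ₚ polarPoint P
  cross≈ₚpolar {A} {C} {P} A≉C A⊥P C⊥P = cross-zero⇒≈ₚ (crossPoint A C A≉C) (polarPoint P)
    (cross-cross-zero (coords A) (coords C) (polar (coords P)) A⊥P C⊥P)

  IsTriangle-rotate : ∀ {P Q R} → IsTriangle P Q R → IsTriangle Q R P
  IsTriangle-rotate {P} {Q} {R} (P≉Q , P≉R , Q≉R , PQ , PR , QR) =
    Q≉R , P≉Q ∘ ≈ₚ-sym {Q} {P} , P≉R ∘ ≈ₚ-sym {R} {P} , QR , Adj-sym {P} {Q} PQ , Adj-sym {P} {R} PR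

  -- If P were isotropic, the polars of P and Q would both be the line PR.
  vertex-nonisotropic : ∀ {P Q R} → IsTriangle P Q R → form P P ≢ 0#
  vertex-nonisotropic {P} {Q} {R} (P≉Q , P≉R , _ , PQ , P⊥R , QR) PP =
    P≉Q (polarPoint-reflects-≈ₚ {P} {Q} (≈ₚ-trans {polarPoint P} {PR} {polarPoint Q}
      (≈ₚ-sym {PR} {polarPoint P} (cross≈ₚpolar {P} {R} {P} P≉R PP RP)) (cross≈ₚpolar {P} {R} {Q} P≉R PQ RQ)))
    where
    PR = crossPoint P R P≉R
    RP = Adj-sym {P} {R} P⊥R
    RQ = Adj-sym {Q} {R} QR

  norm : Point → Carrier
  norm P = conj (x (coords P)) * x (coords P)

  det : Triple → Triple → Triple → Carrier
  det u v w = dot (cross v w) u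

  det-rotate : ∀ u v w → det u v w ≡ det v w u
  det-rotate u v w = solve 9 (λ u₁ u₂ u₃ v₁ v₂ v₃ w₁ w₂ w₃ →
      (v₂ :* w₃ :+ v₃ :* w₂) :* u₁ :+ (v₃ :* w₁ :+ v₁ :* w₃) :* u₂ :+ (v₁ :* w₂ :+ v₂ :* w₁) :* u₃
        := (w₂ :* u₃ :+ w₃ :* u₂) :* v₁ :+ (w₃ :* u₁ :+ w₁ :* u₃) :* v₂ :+ (w₁ :* u₂ :+ w₂ :* u₁) :* v₃)
    refl (x u) (y u) (z u) (x v) (y v) (z v) (x w) (y w) (z w)

  -- The Laplace expansion of a determinant whose first two columns coincide.
  det-repeated-column : ∀ u v w → y (cross v w) * x u + y (cross w u) * x v + y (cross u v) * x w ≡ 0#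
  det-repeated-column u v w = solve 9 (λ u₁ u₂ u₃ v₁ v₂ v₃ w₁ w₂ w₃ →
      (v₃ :* w₁ :+ v₁ :* w₃) :* u₁ :+ (w₃ :* u₁ :+ w₁ :* u₃) :* v₁ :+ (u₃ :* v₁ :+ u₁ :* v₃) :* w₁ := con false)
    refl (x u) (y u) (z u) (x v) (y v) (z v) (x w) (y w) (z w)

  dot-scaleˡ : ∀ c u v → dot (c ·ₜ u) v ≡ c * dot u v
  dot-scaleˡ c u v = solve 7 (λ c u₁ u₂ u₃ v₁ v₂ v₃ →
      c :* u₁ :* v₁ :+ c :* u₂ :* v₂ :+ c :* u₃ :* v₃ := c :* (u₁ :* v₁ :+ u₂ :* v₂ :+ u₃ :* v₃))
    refl c (x u) (y u) (z u) (x v) (y v) (z v)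

  -- The polar of P is the side QR, i.e. polar P = λ (Q × R); then form P P = λ det and norm P = λ y(Q × R) x(P).
  ratio-det : ∀ {P Q R} → IsTriangle P Q R → ∀ {a} → a * form P P ≡ norm P →
              a * det (coords P) (coords Q) (coords R) ≡ y (cross (coords Q) (coords R)) * x (coords P)
              × det (coords P) (coords Q) (coords R) ≢ 0#
  ratio-det {P} {Q} {R} PQR@(_ , _ , Q≉R , PQ , PR , _) {a} a·form≡norm = a·Δ≡ , Δ≢0
    where
    w = cross (coords Q) (coords R)
    Δ = det (coords P) (coords Q) (coords R)
    polar≈ = cross≈ₚpolar {Q} {R} {P} Q≉R (Adj-sym {P} {Q} PQ) (Adj-sym {P} {R} PR)
    λ′ = proj₁ polar≈
    λ′≢0 = proj₁ (proj₂ polar≈)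
    polar≡λw : polar (coords P) ≡ λ′ ·ₜ w
    polar≡λw = proj₂ (proj₂ polar≈)
    form≡λΔ : form P P ≡ λ′ * Δ
    form≡λΔ = trans (cong (λ t → dot t (coords P)) polar≡λw) (dot-scaleˡ λ′ w (coords P))
    Δ≢0 : Δ ≢ 0#
    Δ≢0 Δ≡0 = vertex-nonisotropic {P} {Q} {R} PQR (trans form≡λΔ (trans (cong (λ′ *_) Δ≡0) (zeroʳ λ′)))
    a·Δ≡ : a * Δ ≡ y w * x (coords P)
    a·Δ≡ = *-cancelˡ λ′≢0 (begin
      λ′ * (a * Δ)               ≡⟨ solve 3 (λ l a d → l :* (a :* d) := a :* (l :* d)) refl λ′ a Δ ⟩
      a * (λ′ * Δ)               ≡⟨ cong (a *_) form≡λΔ ⟨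
      a * form P P               ≡⟨ a·form≡norm ⟩
      y (polar (coords P)) * x (coords P) ≡⟨ cong (λ t → y t * x (coords P)) polar≡λw ⟩
      (λ′ * y w) * x (coords P)  ≡⟨ *-assoc λ′ (y w) (x (coords P)) ⟩
      λ′ * (y w * x (coords P))  ∎)

  ratios-sum : ∀ {P Q R} → IsTriangle P Q R → ∀ {a b c} →
               a * form P P ≡ norm P → b * form Q Q ≡ norm Q → c * form R R ≡ norm R → a + b + c ≡ 0#
  ratios-sum {P} {Q} {R} PQR {a} {b} {c} a-ratio b-ratio c-ratio = x*y≡0⇒y≡0 Δ≢0 (begin
    Δ * (a + b + c)
      ≡⟨ solve 4 (λ d a b c → d :* (a :+ b :+ c) := a :* d :+ b :* d :+ c :* d) refl Δ a b c ⟩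
    a * Δ + b * Δ + c * Δ
      ≡⟨ cong₂ (λ s r → a * Δ + b * s + c * r) (det-rotate u v w) Δ≡det-wuv ⟩
    a * Δ + b * det v w u + c * det w u v
      ≡⟨ cong₃ (λ s t r → s + t + r) a·Δ b·Δ c·Δ ⟩
    y (cross v w) * x u + y (cross w u) * x v + y (cross u v) * x w
      ≡⟨ det-repeated-column u v w ⟩
    0# ∎)
    where
    u = coords P ; v = coords Q ; w = coords R
    Δ = det u v w
    QRP = IsTriangle-rotate {P} {Q} {R} PQR
    RPQ = IsTriangle-rotate {Q} {R} {P} QRP
    Δ≡det-wuv = trans (det-rotate u v w) (det-rotate v w u)
    a·Δ = proj₁ (ratio-det {P} {Q} {R} PQR a-ratio)
    Δ≢0 = proj₂ (ratio-det {P} {Q} {R} PQR a-ratio)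
    b·Δ = proj₁ (ratio-det {Q} {R} {P} QRP b-ratio)
    c·Δ = proj₁ (ratio-det {R} {P} {Q} RPQ c-ratio)

  onU⇔ : ∀ l P → OnU l P ⇔ (l * norm P + form P P ≡ 0#)
  onU⇔ l P = mk⇔ (trans (sym lhs≡)) (trans lhs≡)
    where
    X = x (coords P) ; Y = y (coords P) ; Z = z (coords P)
    ^'[q+1] : ∀ a → a ^' (q ℕ.+ 1) ≡ conj a * a
    ^'[q+1] a = trans (^'-homo-* a q 1) (cong (conj a *_) (*-identityʳ a))
    lhs≡ : l * (X ^' (q ℕ.+ 1)) + (X ^' q) * Y + X * (Y ^' q) + (Z ^' (q ℕ.+ 1)) ≡ l * norm P + form P P
    lhs≡ = begin
      l * (X ^' (q ℕ.+ 1)) + conj X * Y + X * conj Y + (Z ^' (q ℕ.+ 1))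
        ≡⟨ cong₂ (λ s t → l * s + conj X * Y + X * conj Y + t) (^'[q+1] X) (^'[q+1] Z) ⟩
      l * (conj X * X) + conj X * Y + X * conj Y + conj Z * Z
        ≡⟨ solve 7 (λ l x y z cx cy cz → l :* (cx :* x) :+ cx :* y :+ x :* cy :+ cz :* z
                                         := l :* (cx :* x) :+ (cy :* x :+ cx :* y :+ cz :* z))
                 refl l X Y Z (conj X) (conj Y) (conj Z) ⟩
      l * norm P + form P P ∎

  onU⇔ratio : ∀ {l P a} → form P P ≢ 0# → a * form P P ≡ norm P → OnU l P ⇔ (l * a ≡ 1#)
  onU⇔ratio {l} {P} {a} n≢0 a·n≡N = mk⇔
    (x+y≡0⇒x≡y ∘ x*y≡0⇒y≡0 n≢0 ∘ trans (*-comm n _) ∘ trans (sym lhs≡) ∘ to (onU⇔ l P))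
    (λ la≡1 → from (onU⇔ l P) (begin
      l * norm P + n    ≡⟨ lhs≡ ⟩
      (l * a + 1#) * n  ≡⟨ cong (λ t → (t + 1#) * n) la≡1 ⟩
      (1# + 1#) * n     ≡⟨ cong (_* n) 1+1≡0 ⟩
      0# * n            ≡⟨ zeroˡ n ⟩
      0#                ∎))
    where
    n = form P P
    lhs≡ : l * norm P + n ≡ (l * a + 1#) * n
    lhs≡ = begin
      l * norm P + n    ≡⟨ cong (λ t → l * t + n) a·n≡N ⟨
      l * (a * n) + n   ≡⟨ solve 3 (λ l a n → l :* (a :* n) :+ n := (l :* a :+ con true) :* n) refl l a n ⟩
      (l * a + 1#) * n  ∎

  ratio+1∈Fq : ∀ {P a} → form P P ≢ 0# → a * form P P ≡ norm P → InFq (a + 1#)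
  ratio+1∈Fq {P} {a} n≢0 a·n≡N = trans (conj-+ a 1#) (cong₂ _+_ conj-a≡a conj-1)
    where
    n = form P P
    X = x (coords P)
    conj-a≡a : conj a ≡ a
    conj-a≡a = *-cancelˡ n≢0 (begin
      n * conj a          ≡⟨ cong (_* conj a) (form-conj P P) ⟩
      conj n * conj a     ≡⟨ *-comm (conj n) (conj a) ⟩
      conj a * conj n     ≡⟨ conj-* a n ⟨
      conj (a * n)        ≡⟨ cong conj a·n≡N ⟩
      conj (conj X * X)   ≡⟨ conj-* (conj X) X ⟩
      conj (conj X) * conj X ≡⟨ cong (_* conj X) (conj-involutive X) ⟩
      X * conj X          ≡⟨ *-comm X (conj X) ⟩
      norm P              ≡⟨ a·n≡N ⟨
      a * n               ≡⟨ *-comm a n ⟩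
      n * a               ∎)

  ratio : ∀ P → form P P ≢ 0# → ∃ λ a → a * form P P ≡ norm P
  ratio P n≢0 = norm P * n⁻¹ , (begin
    (norm P * n⁻¹) * form P P   ≡⟨ *-assoc (norm P) n⁻¹ (form P P) ⟩
    norm P * (n⁻¹ * form P P)   ≡⟨ cong (norm P *_) n⁻¹n≡1 ⟩
    norm P * 1#                 ≡⟨ *-identityʳ (norm P) ⟩
    norm P                      ∎)
    where
    n⁻¹ = proj₁ (inverse (form P P) n≢0)
    n⁻¹n≡1 = trans (*-comm n⁻¹ (form P P)) (proj₂ (inverse (form P P) n≢0))

  Fq-root : ∀ {v} → InFq v → v ^' q + v ≡ 0#
  Fq-root {v} v∈Fq = trans (cong (_+ v) v∈Fq) (x+x≡0 v)

  module _ (H : List Carrier) (good : GoodSubgroup H) where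
    open GoodSubgroup good
    open import Data.List.Membership.DecPropositional _≟_ using (_∈?_)

    inΣ⇔ : ∀ {P a} → form P P ≢ 0# → a * form P P ≡ norm P → InΣ H P ⇔ (a + 1# ∈ H)
    inΣ⇔ {P} {a} n≢0 a·n≡N = mk⇔ InΣ⇒ ⇒InΣ
      where
      InΣ⇒ : InΣ H P → a + 1# ∈ H
      InΣ⇒ ((l , (h , h∈H , l[h+1]≡1) , P∈U) , _) = subst (_∈ H) (sym a+1≡h) h∈H
        where
        la≡1 = to (onU⇔ratio {l} {P} n≢0 a·n≡N) P∈U
        l≢0 : l ≢ 0#
        l≢0 l≡0 = 0≢1 (trans (sym (zeroˡ a)) (trans (cong (_* a) (sym l≡0)) la≡1))
        a+1≡h : a + 1# ≡ h
        a+1≡h = begin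
          a + 1#        ≡⟨ cong (_+ 1#) (*-cancelˡ l≢0 (trans la≡1 (sym l[h+1]≡1))) ⟩
          h + 1# + 1#   ≡⟨ solve 1 (λ h → h :+ con true :+ con true := h) refl h ⟩
          h             ∎
      ⇒InΣ : a + 1# ∈ H → InΣ H P
      ⇒InΣ a+1∈H =
        (a⁻¹ , (a + 1# , a+1∈H , a⁻¹[a+1+1]≡1) , from (onU⇔ratio {a⁻¹} {P} n≢0 a·n≡N) a⁻¹a≡1) , P≉U₂
        where
        a≢0 : a ≢ 0#
        a≢0 a≡0 = no1 (subst (_∈ H) (trans (cong (_+ 1#) a≡0) (+-identityˡ 1#)) a+1∈H)
        a⁻¹ = proj₁ (inverse a a≢0)
        a⁻¹a≡1 : a⁻¹ * a ≡ 1#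
        a⁻¹a≡1 = trans (*-comm a⁻¹ a) (proj₂ (inverse a a≢0))
        a⁻¹[a+1+1]≡1 : a⁻¹ * (a + 1# + 1#) ≡ 1#
        a⁻¹[a+1+1]≡1 = trans (cong (a⁻¹ *_) (solve 1 (λ a → a :+ con true :+ con true := a) refl a)) a⁻¹a≡1
        P≉U₂ : ¬ P ≈ₚ U₂
        P≉U₂ (c , c≢0 , U₂≡cP) = a≢0 (*-cancelˡ n≢0 (begin
          form P P * a      ≡⟨ *-comm (form P P) a ⟩
          a * form P P      ≡⟨ a·n≡N ⟩
          conj X * X        ≡⟨ cong (conj X *_) X≡0 ⟩
          conj X * 0#       ≡⟨ zeroʳ (conj X) ⟩
          0#                ≡⟨ zeroʳ (form P P) ⟨
          form P P * 0#     ∎))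
          where
          X = x (coords P)
          X≡0 : X ≡ 0#
          X≡0 = x*y≡0⇒y≡0 c≢0 (sym (cong x U₂≡cP))

    1+H : List Carrier
    1+H = map (1# +_) H

    1+-injective : ∀ {a b} → 1# + a ≡ 1# + b → a ≡ b
    1+-injective {a} {b} eq = begin
      a               ≡⟨ solve 1 (λ a → a := con true :+ (con true :+ a)) refl a ⟩
      1# + (1# + a)   ≡⟨ cong (1# +_) eq ⟩
      1# + (1# + b)   ≡⟨ solve 1 (λ b → con true :+ (con true :+ b) := b) refl b ⟩
      b               ∎

    H-disjoint-1+H : ∀ {v} → ¬ (v ∈ H × v ∈ 1+H)
    H-disjoint-1+H (v∈H , v∈1+H) with ∈-map⁻ (1# +_) v∈1+H
    ... | h , h∈H , refl =
      no1 (subst (_∈ H) (solve 1 (λ h → con true :+ h :+ h := con true) refl h) (closed+ v∈H h∈H))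

    H++1+H-unique : Unique (H ++ 1+H)
    H++1+H-unique = ++⁺ unique (map⁺ 1+-injective unique) H-disjoint-1+H

    H++1+H⊆Fq : All InFq (H ++ 1+H)
    H++1+H⊆Fq = All.tabulate Fq
      where
      Fq : ∀ {v} → v ∈ H ++ 1+H → InFq v
      Fq v∈ with ∈-++⁻ H v∈
      ... | inj₁ v∈H   = inFq v∈H
      ... | inj₂ v∈1+H with ∈-map⁻ (1# +_) v∈1+H
      ...   | h , h∈H , refl = trans (conj-+ 1# h) (cong₂ _+_ conj-1 (inFq h∈H))

    |H++1+H|≡q : length (H ++ 1+H) ≡ q
    |H++1+H|≡q = begin
      length (H ++ 1+H)         ≡⟨ length-++ H ⟩
      length H ℕ.+ length 1+H   ≡⟨ cong (length H ℕ.+_) (length-map (1# +_) H) ⟩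
      length H ℕ.+ length H     ≡⟨ cong (length H ℕ.+_) (ℕP.+-identityʳ (length H)) ⟨
      2 ℕ.* length H            ≡⟨ order ⟩
      q                         ∎

    x^q+x-monic : Monic q (λ v → v ^' q + v)
    x^q+x-monic = subst (λ n → Monic n (λ v → v ^' n + v)) 2+2m≡q (monic-^'+id (m ℕ.+ m))
      where
      nonempty : ∀ {xs : List Carrier} {v} → v ∈ xs → ∃ λ m → length xs ≡ suc m
      nonempty {_ ∷ xs} _ = length xs , refl
      m = proj₁ (nonempty has0)
      2+2m≡q : suc (suc (m ℕ.+ m)) ≡ q
      2+2m≡q = begin
        suc (suc (m ℕ.+ m))   ≡⟨ cong suc (ℕP.+-suc m m) ⟨
        suc m ℕ.+ suc m       ≡⟨ cong (suc m ℕ.+_) (ℕP.+-identityʳ (suc m)) ⟨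
        2 ℕ.* suc m           ≡⟨ cong (2 ℕ.*_) (proj₂ (nonempty has0)) ⟨
        2 ℕ.* length H        ≡⟨ order ⟩
        q                     ∎

    -- H ∪ (1 + H) already has q elements, all roots of xᵠ + x;
    -- another element of 𝔽_q would be a root too many.
    index-two : ∀ {t} → InFq t → t ∉ H → t + 1# ∈ H
    index-two {t} t∈Fq t∉H with t + 1# ∈? H
    ... | yes t+1∈H = t+1∈H
    ... | no  t+1∉H = ⊥-elim (ℕP.<-irrefl refl (subst (ℕ._≤ q) (cong suc |H++1+H|≡q)
            (roots-bound x^q+x-monic (All.tabulate t≢ ∷ H++1+H-unique) (All.map Fq-root (t∈Fq ∷ H++1+H⊆Fq)))))
      where
      t≢ : ∀ {v} → v ∈ H ++ 1+H → t ≢ v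
      t≢ v∈ refl with ∈-++⁻ H v∈
      ... | inj₁ t∈H   = t∉H t∈H
      ... | inj₂ t∈1+H with ∈-map⁻ (1# +_) t∈1+H
      ...   | h , h∈H , refl = t+1∉H (subst (_∈ H) (solve 1 (λ h → h := con true :+ h :+ con true) refl h) h∈H)

    single-sum∈H : ∀ {h₁ h₂ h₃} → h₁ ∈ H → InFq h₂ → h₂ ∉ H → InFq h₃ → h₃ ∉ H → h₁ + h₂ + h₃ ∈ H
    single-sum∈H {h₁} {h₂} {h₃} h₁∈H h₂∈Fq h₂∉H h₃∈Fq h₃∉H =
      subst (_∈ H) (solve 3 (λ a b c → a :+ (b :+ con true) :+ (c :+ con true) := a :+ b :+ c) refl h₁ h₂ h₃)
        (closed+ (closed+ h₁∈H (index-two h₂∈Fq h₂∉H)) (index-two h₃∈Fq h₃∉H))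

    zeroOrTwo-of-sum∉H : ∀ {P Q R h₁ h₂ h₃} →
                         InΣ H P ⇔ (h₁ ∈ H) → InΣ H Q ⇔ (h₂ ∈ H) → InΣ H R ⇔ (h₃ ∈ H) →
                         InFq h₁ → InFq h₂ → InFq h₃ → h₁ + h₂ + h₃ ∉ H → ZeroOrTwo (InΣ H) P Q R
    zeroOrTwo-of-sum∉H {h₁ = h₁} {h₂} {h₃} P⇔ Q⇔ R⇔ Fq₁ Fq₂ Fq₃ sum∉H
      with h₁ ∈? H | h₂ ∈? H | h₃ ∈? H
    ... | no  ∉₁ | no  ∉₂ | no  ∉₃ = inj₁ (∉₁ ∘ to P⇔ , ∉₂ ∘ to Q⇔ , ∉₃ ∘ to R⇔)
    ... | yes ∈₁ | yes ∈₂ | no  ∉₃ = inj₂ (inj₁ (from P⇔ ∈₁ , from Q⇔ ∈₂ , ∉₃ ∘ to R⇔))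
    ... | yes ∈₁ | no  ∉₂ | yes ∈₃ = inj₂ (inj₂ (inj₁ (from P⇔ ∈₁ , ∉₂ ∘ to Q⇔ , from R⇔ ∈₃)))
    ... | no  ∉₁ | yes ∈₂ | yes ∈₃ = inj₂ (inj₂ (inj₂ (∉₁ ∘ to P⇔ , from Q⇔ ∈₂ , from R⇔ ∈₃)))
    ... | yes ∈₁ | yes ∈₂ | yes ∈₃ = ⊥-elim (sum∉H (closed+ (closed+ ∈₁ ∈₂) ∈₃))
    ... | yes ∈₁ | no  ∉₂ | no  ∉₃ = ⊥-elim (sum∉H (single-sum∈H ∈₁ Fq₂ ∉₂ Fq₃ ∉₃))
    ... | no  ∉₁ | yes ∈₂ | no  ∉₃ =
      ⊥-elim (sum∉H (subst (_∈ H) (cong (_+ h₃) (+-comm h₂ h₁)) (single-sum∈H ∈₂ Fq₁ ∉₁ Fq₃ ∉₃)))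
    ... | no  ∉₁ | no  ∉₂ | yes ∈₃ =
      ⊥-elim (sum∉H (subst (_∈ H) (solve 3 (λ a b c → c :+ a :+ b := a :+ b :+ c) refl h₁ h₂ h₃)
                                  (single-sum∈H ∈₃ Fq₁ ∉₁ Fq₂ ∉₂)))

    triangle-zeroOrTwo : ∀ {P Q R} → IsTriangle P Q R → ZeroOrTwo (InΣ H) P Q R
    triangle-zeroOrTwo {P} {Q} {R} PQR =
      zeroOrTwo-of-sum∉H {P} {Q} {R} (inΣ⇔ {P} nP a-ratio) (inΣ⇔ {Q} nQ b-ratio) (inΣ⇔ {R} nR c-ratio)
        (ratio+1∈Fq {P} nP a-ratio) (ratio+1∈Fq {Q} nQ b-ratio) (ratio+1∈Fq {R} nR c-ratio)
        (no1 ∘ subst (_∈ H) shifted-sum≡1)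
      where
      QRP = IsTriangle-rotate {P} {Q} {R} PQR
      RPQ = IsTriangle-rotate {Q} {R} {P} QRP
      nP = vertex-nonisotropic {P} {Q} {R} PQR
      nQ = vertex-nonisotropic {Q} {R} {P} QRP
      nR = vertex-nonisotropic {R} {P} {Q} RPQ
      a = proj₁ (ratio P nP) ; a-ratio = proj₂ (ratio P nP)
      b = proj₁ (ratio Q nQ) ; b-ratio = proj₂ (ratio Q nQ)
      c = proj₁ (ratio R nR) ; c-ratio = proj₂ (ratio R nR)
      shifted-sum≡1 : (a + 1#) + (b + 1#) + (c + 1#) ≡ 1#
      shifted-sum≡1 = begin
        (a + 1#) + (b + 1#) + (c + 1#) ≡⟨ solve 3 (λ a b c → (a :+ con true) :+ (b :+ con true) :+ (c :+ con true)
                                                             := (a :+ b :+ c) :+ con true) refl a b c ⟩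
        a + b + c + 1#                  ≡⟨ cong (_+ 1#) (ratios-sum {P} {Q} {R} PQR a-ratio b-ratio c-ratio) ⟩
        0# + 1#                         ≡⟨ +-identityˡ 1# ⟩
        1#                              ∎

open import Data.Nat using (_^_; _*_)

corollary2 : ∀ {ℓ : Level} (F : Field ℓ) (k : ℕ) →
    let open FieldTheory F
        open Unitary (2 ^ k)
    in HasOrder ((2 ^ k) * (2 ^ k)) →
       (H : List (Field.Carrier F)) → GoodSubgroup H →
       ∀ P Q R → IsTriangle P Q R → ZeroOrTwo (InΣ H) P Q R
corollary2 F k order H good P Q R =
  UnitaryPlane.triangle-zeroOrTwo F k _≟_ char-2 fermat H good {P} {Q} {R}
  where
  open FiniteField F order using (_≟_; fermat; characteristic-two)
  even-order : 2 ^ k * 2 ^ k ≡ 2 * (length H * 2 ^ k)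
  even-order = trans (cong (_* 2 ^ k) (sym (FieldTheory.Unitary.GoodSubgroup.order good)))
                     (ℕP.*-assoc 2 (length H) (2 ^ k))
  char-2 = characteristic-two (length H * 2 ^ k) even-order
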